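{- Let $q$ be a power of an odd prime and $d \geq 1$. There is an absolute constant $C>0$ such that the following holds. If $A,B \subset \mathbb{F}_q^d$ with $A \cap B = \emptyset$ and $|A|^2|B| > C q^{d+2}$, then there are $x,y \in A$ and $z \in B$ such that $(x,y,z)$ forms a right angle.
   Context: An ordered triple $(x,y,z) \in \mathbb{F}_q^d \times \mathbb{F}_q^d \times \mathbb{F}_q^d$ forms a right angle if $x,y,z$ are distinct and $(x-y)\cdot(z-y) = 0$, where $u \cdot v = \sum_{i=1}^d u_i v_i$. -}

module Defs where

open import Level using (0ℓ)
open import Data.Nat using (ℕ)
open import Data.Fin using (Fin)
open import Data.Vec using (Vec; zipWith; foldr)
open import Data.Product using (∃)
open import Function.Bundles using (_↔_)
open import Relation.Binary.PropositionalEquality using (_≡_; _≢_)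
open import Algebra.Structures using (IsCommutativeRing)

-- A finite field: a commutative ring (with propositional equality) in which
-- 0 ≠ 1 and every nonzero element has a multiplicative inverse, whose carrier
-- is in bijection with Fin size (so size = |F| = q).
record FiniteField : Set₁ where
  infixl 6 _+_
  infixl 7 _*_
  field
    Carrier : Set
    _+_ _*_ : Carrier → Carrier → Carrier
    -_      : Carrier → Carrier
    0# 1#   : Carrier
    isCommutativeRing : IsCommutativeRing _≡_ _+_ _*_ -_ 0# 1#
    0≢1     : 0# ≢ 1#
    inverse : ∀ x → x ≢ 0# → ∃ λ y → x * y ≡ 1#
    size    : ℕ
    enum    : Fin size ↔ Carrier

module Geometry (F : FiniteField) where
  open FiniteField F

  _⊖_ : ∀ {d} → Vec Carrier d → Vec Carrier d → Vec Carrier d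
  u ⊖ v = zipWith (λ a b → a + (- b)) u v

  _·_ : ∀ {d} → Vec Carrier d → Vec Carrier d → Carrier
  u · v = foldr _ _+_ 0# (zipWith _*_ u v)

  RightAngle : ∀ {d} → Vec Carrier d → Vec Carrier d → Vec Carrier d → Set
  RightAngle x y z = x ≢ y × y ≢ z × x ≢ z × ((x ⊖ y) · (z ⊖ y) ≡ 0#)
    where open import Data.Product using (_×_)

module Submission where

-- Proof: a second-moment count over the q^(d+1) "hyperplanes" (n , c) ∈
-- F^d × F, with on(n , c) = |{x ∈ A : n · x = c}|.  Each point lies on one
-- hyperplane per normal n, and two distinct points share one for at most
-- q^(d−1) normals, so Σ on = a q^d and Σ on² ≤ a (a q^(d−1) + q^d); expanding
-- the square gives Σ (a − q·on)² ≤ a q^(d+2).  If there is no right angle,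
-- the hyperplane through y ∈ A with normal z − y (z ∈ B) meets A only in y,
-- and distinct pairs (y, z) give distinct hyperplanes; hence the same sum is
-- at least ab (a − q)².  So b (a − q)² ≤ q^(d+2), and with b ≤ q^d this
-- gives a² b ≤ 4 q^(d+2).

open import Defs
open import Level using (0ℓ)
open import Data.Nat using (ℕ; zero; suc; _<_; _≤_; _*_; _^_; _+_; _∸_; ∣_-_∣; z≤n; s≤s; >-nonZero)
open import Data.Nat.Properties
  using ( +-assoc; +-comm; +-identityʳ; *-assoc; *-comm; *-identityˡ; *-identityʳ; *-zeroʳ
        ; *-distribˡ-+; ^-distribˡ-+-*; ≤-refl; ≤-reflexive; ≤-trans; ≤-total; _≤?_; <⇒≤; ≰⇒>; <⇒≱
        ; m≤m+n; m≤n+m; +-mono-≤; +-monoˡ-≤; +-monoʳ-≤; *-mono-≤; *-monoˡ-≤; *-monoʳ-≤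
        ; +-cancelˡ-≤; *-cancelˡ-≤; ∸-monoʳ-≤; m+[n∸m]≡n; m≤n⇒∃[o]m+o≡n
        ; m∸n≤∣m-n∣; ∣m-m+n∣≡n; ∣-∣-comm; module ≤-Reasoning )
open import Data.Nat.Solver using (module +-*-Solver)
open import Data.Nat.Primality using (Prime)
open import Data.Fin using (Fin)
open import Data.Fin.Properties using () renaming (_≟_ to _≟Fin_)
open import Data.Vec using (Vec; []; _∷_; replicate)
import Data.Vec.Properties as Vec
open import Data.List using (List; []; _∷_; _++_; map; length; tabulate; cartesianProductWith; cartesianProduct)
open import Data.List.Properties using (length-++; length-map; length-tabulate)
open import Data.List.Membership.Propositional using (_∈_; _∉_; find; lose)
open import Data.List.Membership.Propositional.Properties
  using (∈-tabulate⁺; ∈-cartesianProductWith⁺; ∈-cartesianProduct⁺; ∈-cartesianProduct⁻)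
open import Data.List.Relation.Unary.Any using (here; there; any?)
import Data.List.Relation.Unary.All as All
open import Data.List.Relation.Unary.AllPairs using ([]; _∷_)
open import Data.List.Relation.Unary.Unique.Propositional using (Unique)
open import Data.List.Relation.Unary.Unique.Propositional.Properties
  using (tabulate⁺; cartesianProductWith⁺; cartesianProduct⁺)
open import Data.Product using (Σ; ∃; _×_; _,_; proj₁; proj₂; Σ-syntax; ∃-syntax)
import Data.Product.Properties as Product
open import Data.Sum using (inj₁; inj₂)
open import Data.Empty using (⊥-elim)
open import Function.Bundles using (_↔_; Inverse; Injection)
open import Function.Properties.Inverse using (↔⇒↣)
open import Relation.Nullary using (Dec; yes; no; ¬_; ¬?)
open import Relation.Nullary.Decidable using (map′; _×-dec_)
open import Relation.Binary.Definitions using (DecidableEquality)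
open import Relation.Binary.PropositionalEquality
open import Algebra.Bundles using (CommutativeRing)

private
  variable
    X Y Z : Set

𝟙 : {P : Set} → Dec P → ℕ
𝟙 (yes _) = 1
𝟙 (no _)  = 0

𝟙≤1 : {P : Set} (p? : Dec P) → 𝟙 p? ≤ 1
𝟙≤1 (yes _) = s≤s z≤n
𝟙≤1 (no _)  = z≤n

𝟙-mono : {P Q : Set} (p? : Dec P) (q? : Dec Q) → (P → Q) → 𝟙 p? ≤ 𝟙 q?
𝟙-mono (yes p) (yes _) _   = ≤-refl
𝟙-mono (yes p) (no ¬q) P⇒Q = ⊥-elim (¬q (P⇒Q p))
𝟙-mono (no _)  _       _   = z≤n

∑ : List X → (X → ℕ) → ℕ
∑ []       f = 0
∑ (x ∷ xs) f = f x + ∑ xs f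

syntax ∑ L (λ x → e) = ∑[ x ∈ L ] e

∑-cong : (L : List X) {f g : X → ℕ} → (∀ x → f x ≡ g x) → ∑ L f ≡ ∑ L g
∑-cong []       f≗g = refl
∑-cong (x ∷ xs) f≗g = cong₂ _+_ (f≗g x) (∑-cong xs f≗g)

∑-mono : (L : List X) {f g : X → ℕ} → (∀ x → x ∈ L → f x ≤ g x) → ∑ L f ≤ ∑ L g
∑-mono []       f≤g = z≤n
∑-mono (x ∷ xs) f≤g = +-mono-≤ (f≤g x (here refl)) (∑-mono xs (λ y y∈ → f≤g y (there y∈)))

∑-+ : (L : List X) (f g : X → ℕ) → ∑[ x ∈ L ] (f x + g x) ≡ ∑ L f + ∑ L g
∑-+ []       f g = refl
∑-+ (x ∷ xs) f g = begin
  (f x + g x) + ∑[ y ∈ xs ] (f y + g y) ≡⟨ cong (f x + g x +_) (∑-+ xs f g) ⟩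
  (f x + g x) + (∑ xs f + ∑ xs g)       ≡⟨ +-assoc (f x) (g x) _ ⟩
  f x + (g x + (∑ xs f + ∑ xs g))       ≡⟨ cong (f x +_) (+-comm (g x) _) ⟩
  f x + ((∑ xs f + ∑ xs g) + g x)       ≡⟨ cong (f x +_) (+-assoc (∑ xs f) _ _) ⟩
  f x + (∑ xs f + (∑ xs g + g x))       ≡⟨ sym (+-assoc (f x) _ _) ⟩
  (f x + ∑ xs f) + (∑ xs g + g x)       ≡⟨ cong (f x + ∑ xs f +_) (+-comm (∑ xs g) (g x)) ⟩
  (f x + ∑ xs f) + (g x + ∑ xs g)       ∎
  where open ≡-Reasoning

∑-*ˡ : (L : List X) (k : ℕ) (f : X → ℕ) → ∑[ x ∈ L ] (k * f x) ≡ k * ∑ L f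
∑-*ˡ []       k f = sym (*-zeroʳ k)
∑-*ˡ (x ∷ xs) k f = trans (cong (k * f x +_) (∑-*ˡ xs k f)) (sym (*-distribˡ-+ k (f x) _))

∑-*ʳ : (L : List X) (k : ℕ) (f : X → ℕ) → ∑[ x ∈ L ] (f x * k) ≡ ∑ L f * k
∑-*ʳ L k f = begin
  ∑[ x ∈ L ] (f x * k) ≡⟨ ∑-cong L (λ x → *-comm (f x) k) ⟩
  ∑[ x ∈ L ] (k * f x) ≡⟨ ∑-*ˡ L k f ⟩
  k * ∑ L f            ≡⟨ *-comm k _ ⟩
  ∑ L f * k            ∎
  where open ≡-Reasoning

∑-const : (L : List X) (k : ℕ) → ∑[ x ∈ L ] k ≡ length L * k
∑-const []       k = refl
∑-const (x ∷ xs) k = cong (k +_) (∑-const xs k)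

∑-++ : (L M : List X) (f : X → ℕ) → ∑ (L ++ M) f ≡ ∑ L f + ∑ M f
∑-++ []       M f = refl
∑-++ (x ∷ xs) M f = trans (cong (f x +_) (∑-++ xs M f)) (sym (+-assoc (f x) _ _))

∑-product : (L : List X) (M : List Y) (f : X → ℕ) (g : Y → ℕ) →
            ∑ L f * ∑ M g ≡ ∑[ x ∈ L ] ∑[ y ∈ M ] (f x * g y)
∑-product L M f g = begin
  ∑ L f * ∑ M g                     ≡⟨ sym (∑-*ʳ L (∑ M g) f) ⟩
  ∑[ x ∈ L ] (f x * ∑ M g)          ≡⟨ ∑-cong L (λ x → sym (∑-*ˡ M (f x) g)) ⟩
  ∑[ x ∈ L ] ∑[ y ∈ M ] (f x * g y) ∎
  where open ≡-Reasoning

∑-swap : (L : List X) (M : List Y) (f : X → Y → ℕ) →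
         ∑[ x ∈ L ] ∑[ y ∈ M ] f x y ≡ ∑[ y ∈ M ] ∑[ x ∈ L ] f x y
∑-swap []       M f = sym (trans (∑-const M 0) (*-zeroʳ (length M)))
∑-swap (x ∷ xs) M f = trans (cong (∑ M (f x) +_) (∑-swap xs M f)) (sym (∑-+ M (f x) _))

∑-cartesianProductWith : (g : X → Y → Z) (L : List X) (M : List Y) (f : Z → ℕ) →
  ∑ (cartesianProductWith g L M) f ≡ ∑[ x ∈ L ] ∑[ y ∈ M ] f (g x y)
∑-cartesianProductWith g []       M f = refl
∑-cartesianProductWith g (x ∷ xs) M f = begin
  ∑ (map (g x) M ++ cartesianProductWith g xs M) f
    ≡⟨ ∑-++ (map (g x) M) _ f ⟩
  ∑ (map (g x) M) f + ∑ (cartesianProductWith g xs M) f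
    ≡⟨ cong₂ _+_ (∑-map M) (∑-cartesianProductWith g xs M f) ⟩
  ∑[ y ∈ M ] f (g x y) + ∑[ x′ ∈ xs ] ∑[ y ∈ M ] f (g x′ y) ∎
  where
  open ≡-Reasoning
  ∑-map : (N : List _) → ∑ (map (g x) N) f ≡ ∑[ y ∈ N ] f (g x y)
  ∑-map []       = refl
  ∑-map (y ∷ ys) = cong (f (g x y) +_) (∑-map ys)

count≤1 : (L : List X) → Unique L → {P : X → Set} (P? : ∀ x → Dec (P x)) →
          (∀ x y → x ∈ L → y ∈ L → P x → P y → x ≡ y) → ∑[ x ∈ L ] 𝟙 (P? x) ≤ 1
count≤1 []       _            P? same = z≤n
count≤1 (x ∷ xs) (x∉xs ∷ uxs) P? same with P? x
... | no _   = count≤1 xs uxs P? (λ y z y∈ z∈ → same y z (there y∈) (there z∈))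
... | yes Px = ≤-reflexive (cong suc (none xs (λ y∈ → y∈)))
  where
  -- no element of xs shares the property with x, since x ∉ xs
  none : (M : List _) → (∀ {y} → y ∈ M → y ∈ xs) → ∑[ y ∈ M ] 𝟙 (P? y) ≡ 0
  none []       _    = refl
  none (y ∷ ys) M⊆xs with P? y
  ... | yes Py = ⊥-elim (All.lookup x∉xs y∈xs (same x y (here refl) (there y∈xs) Px Py))
    where y∈xs = M⊆xs (here refl)
  ... | no _   = none ys (λ y∈ → M⊆xs (there y∈))

∑-pick : (_≟_ : DecidableEquality X) (L : List X) → Unique L → {u : X} → u ∈ L →
         (h : X → ℕ) → ∑[ y ∈ L ] (𝟙 (u ≟ y) * h y) ≡ h u
∑-pick _≟_ (y ∷ ys) (y∉ys ∷ uys) {u} u∈ h with u ≟ y | u∈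
... | yes refl | _         = begin
  (h u + 0) + ∑[ z ∈ ys ] (𝟙 (u ≟ z) * h z) ≡⟨ cong ((h u + 0) +_) (vanish ys (All.lookup y∉ys)) ⟩
  (h u + 0) + 0                            ≡⟨ trans (+-identityʳ _) (+-identityʳ _) ⟩
  h u                                      ∎
  where
  open ≡-Reasoning
  -- u occurs nowhere else, so the remaining indicators vanish
  vanish : (M : List _) → (∀ {z} → z ∈ M → u ≢ z) → ∑[ z ∈ M ] (𝟙 (u ≟ z) * h z) ≡ 0
  vanish []       _  = refl
  vanish (z ∷ zs) u∉ with u ≟ z
  ... | yes u≡z = ⊥-elim (u∉ (here refl) u≡z)
  ... | no _    = vanish zs (λ z∈ → u∉ (there z∈))
... | no u≢y  | here u≡y  = ⊥-elim (u≢y u≡y)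
... | no _    | there u∈ys = ∑-pick _≟_ ys uys u∈ys h

record Enumeration (X : Set) : Set where
  field
    elements : List X
    unique   : Unique elements
    complete : ∀ x → x ∈ elements

open Enumeration

∑-injective : (_≟_ : DecidableEquality Y) (E : Enumeration Y) →
              (L : List X) → Unique L → (φ : X → Y) →
              (∀ x x′ → x ∈ L → x′ ∈ L → φ x ≡ φ x′ → x ≡ x′) →
              (G : Y → ℕ) → ∑[ x ∈ L ] G (φ x) ≤ ∑ (elements E) G
∑-injective _≟_ E L uL φ φ-inj G = begin
  ∑[ x ∈ L ] G (φ x)                         ≡⟨ ∑-cong L (λ x → sym (∑-pick _≟_ Y* (unique E) (complete E (φ x)) G)) ⟩
  ∑[ x ∈ L ] ∑[ p ∈ Y* ] (𝟙 (φ x ≟ p) * G p) ≡⟨ ∑-swap L Y* _ ⟩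
  ∑[ p ∈ Y* ] ∑[ x ∈ L ] (𝟙 (φ x ≟ p) * G p) ≡⟨ ∑-cong Y* (λ p → ∑-*ʳ L (G p) (λ x → 𝟙 (φ x ≟ p))) ⟩
  ∑[ p ∈ Y* ] (∑[ x ∈ L ] 𝟙 (φ x ≟ p) * G p) ≤⟨ ∑-mono Y* (λ p _ → *-monoˡ-≤ (G p) (fibre≤1 p)) ⟩
  ∑[ p ∈ Y* ] (1 * G p)                      ≡⟨ ∑-cong Y* (λ p → *-identityˡ (G p)) ⟩
  ∑ Y* G                                     ∎
  where
  open ≤-Reasoning
  Y* = elements E
  fibre≤1 : ∀ p → ∑[ x ∈ L ] 𝟙 (φ x ≟ p) ≤ 1
  fibre≤1 p = count≤1 L uL (λ x → φ x ≟ p)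
                (λ x x′ x∈ x′∈ φx≡p φx′≡p → φ-inj x x′ x∈ x′∈ (trans φx≡p (sym φx′≡p)))

length-cartesianProductWith : (g : X → Y → Z) (L : List X) (M : List Y) →
  length (cartesianProductWith g L M) ≡ length L * length M
length-cartesianProductWith g []       M = refl
length-cartesianProductWith g (x ∷ xs) M = begin
  length (map (g x) M ++ cartesianProductWith g xs M)     ≡⟨ length-++ (map (g x) M) ⟩
  length (map (g x) M) + length (cartesianProductWith g xs M)
    ≡⟨ cong₂ _+_ (length-map (g x) M) (length-cartesianProductWith g xs M) ⟩
  length M + length xs * length M                         ∎
  where open ≡-Reasoning

fromFin : {n : ℕ} → Fin n ↔ X → Enumeration X
fromFin e = record
  { elements = tabulate to
  ; unique   = tabulate⁺ (Injection.injective (↔⇒↣ e))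
  ; complete = λ x → subst (_∈ tabulate to) (strictlyInverseˡ x) (∈-tabulate⁺ (from x))
  }
  where open Inverse e

length-fromFin : {n : ℕ} (e : Fin n ↔ X) → length (elements (fromFin e)) ≡ n
length-fromFin e = length-tabulate (Inverse.to e)

vectors : List X → (d : ℕ) → List (Vec X d)
vectors L zero    = [] ∷ []
vectors L (suc d) = cartesianProductWith _∷_ L (vectors L d)

vectorEnum : Enumeration X → (d : ℕ) → Enumeration (Vec X d)
vectorEnum E d = record { elements = vectors (elements E) d ; unique = uniq d ; complete = compl }
  where
  uniq : ∀ d → Unique (vectors (elements E) d)
  uniq zero    = All.[] ∷ []
  uniq (suc d) = cartesianProductWith⁺ _∷_ Vec.∷-injective (unique E) (uniq d)
  compl : ∀ {d} (v : Vec _ d) → v ∈ vectors (elements E) d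
  compl []       = here refl
  compl (x ∷ xs) = ∈-cartesianProductWith⁺ _∷_ (complete E x) (compl xs)

length-vectors : (L : List X) (d : ℕ) → length (vectors L d) ≡ length L ^ d
length-vectors L zero    = refl
length-vectors L (suc d) = trans (length-cartesianProductWith _∷_ L (vectors L d)) (cong (length L *_) (length-vectors L d))

productEnum : Enumeration X → Enumeration Y → Enumeration (X × Y)
productEnum E E′ = record
  { elements = cartesianProduct (elements E) (elements E′)
  ; unique   = cartesianProduct⁺ (unique E) (unique E′)
  ; complete = λ (x , y) → ∈-cartesianProduct⁺ (complete E x) (complete E′ y)
  }

search₃ : {R : X → Y → Z → Set} → (∀ x y z → Dec (R x y z)) → (L : List X) (M : List Y) (N : List Z) →
          Dec (∃[ x ] ∃[ y ] ∃[ z ] (x ∈ L × y ∈ M × z ∈ N × R x y z))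
search₃ R? L M N with any? (λ x → any? (λ y → any? (R? x y) N) M) L
... | no miss = no λ (x , y , z , x∈ , y∈ , z∈ , r) → miss (lose x∈ (lose y∈ (lose z∈ r)))
... | yes hit with find hit
...   | x , x∈ , hitʸ with find hitʸ
...     | y , y∈ , hitᶻ with find hitᶻ
...       | z , z∈ , r = yes (x , y , z , x∈ , y∈ , z∈ , r)

square-gap-≤ : ∀ {m n} → m ≤ n → m * m + n * n ≡ 2 * (m * n) + ∣ m - n ∣ * ∣ m - n ∣
square-gap-≤ {m} m≤n with m≤n⇒∃[o]m+o≡n m≤n
... | t , refl = begin
  m * m + (m + t) * (m + t)
    ≡⟨ solve 2 (λ m t → m :* m :+ (m :+ t) :* (m :+ t) := con 2 :* (m :* (m :+ t)) :+ t :* t) refl m t ⟩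
  2 * (m * (m + t)) + t * t  ≡⟨ cong (λ s → 2 * (m * (m + t)) + s * s) (sym (∣m-m+n∣≡n m t)) ⟩
  2 * (m * (m + t)) + ∣ m - m + t ∣ * ∣ m - m + t ∣ ∎
  where
  open ≡-Reasoning
  open +-*-Solver

square-gap : ∀ m n → m * m + n * n ≡ 2 * (m * n) + ∣ m - n ∣ * ∣ m - n ∣
square-gap m n with ≤-total m n
... | inj₁ m≤n = square-gap-≤ m≤n
... | inj₂ n≤m = begin
  m * m + n * n                             ≡⟨ +-comm (m * m) (n * n) ⟩
  n * n + m * m                             ≡⟨ square-gap-≤ n≤m ⟩
  2 * (n * m) + ∣ n - m ∣ * ∣ n - m ∣       ≡⟨ cong₂ (λ u v → 2 * u + v * v) (*-comm n m) (∣-∣-comm n m) ⟩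
  2 * (m * n) + ∣ m - n ∣ * ∣ m - n ∣       ∎
  where open ≡-Reasoning

-- If b(a − q)² ≤ q²Q and b ≤ Q then a²b ≤ 4q²Q: either a ≤ 2q, or
-- a − q ≥ a/2.
four-bound : ∀ a b q Q → b * ((a ∸ q) * (a ∸ q)) ≤ q * q * Q → b ≤ Q → a * a * b ≤ 4 * (q * q * Q)
four-bound a b q Q gap b≤Q with a ≤? q + q
... | yes a≤2q = begin
  a * a * b              ≤⟨ *-mono-≤ (*-mono-≤ a≤2q a≤2q) b≤Q ⟩
  (q + q) * (q + q) * Q  ≡⟨ solve 2 (λ q Q → (q :+ q) :* (q :+ q) :* Q := con 4 :* (q :* q :* Q)) refl q Q ⟩
  4 * (q * q * Q)        ∎
  where
  open ≤-Reasoning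
  open +-*-Solver
... | no a≰2q = begin
  a * a * b              ≤⟨ *-monoˡ-≤ b (*-mono-≤ a≤2t a≤2t) ⟩
  (t + t) * (t + t) * b  ≡⟨ solve 2 (λ t b → (t :+ t) :* (t :+ t) :* b := con 4 :* (b :* (t :* t))) refl t b ⟩
  4 * (b * (t * t))      ≤⟨ *-monoʳ-≤ 4 gap ⟩
  4 * (q * q * Q)        ∎
  where
  open ≤-Reasoning
  open +-*-Solver
  t = a ∸ q
  q≤a : q ≤ a
  q≤a = ≤-trans (m≤m+n q q) (<⇒≤ (≰⇒> a≰2q))
  -- a = q + t with q < t, hence a ≤ 2t
  a≤2t : a ≤ t + t
  a≤2t = begin
    a      ≡⟨ sym (m+[n∸m]≡n q≤a) ⟩
    q + t  ≤⟨ +-monoˡ-≤ t (+-cancelˡ-≤ q q t (<⇒≤ (subst (q + q <_) (sym (m+[n∸m]≡n q≤a)) (≰⇒> a≰2q)))) ⟩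
    t + t  ∎

-- Cancelling the cross terms of an expanded sum of squares.
cancel-cross : ∀ M S T U → M + S ≡ (M + M) + T → S ≤ M + U → T ≤ U
cancel-cross M S T U expand S≤ = +-cancelˡ-≤ (M + M) T U (begin
  (M + M) + T  ≡⟨ sym expand ⟩
  M + S        ≤⟨ +-monoʳ-≤ M S≤ ⟩
  M + (M + U)  ≡⟨ sym (+-assoc M M U) ⟩
  (M + M) + U  ∎)
  where open ≤-Reasoning

∑-square-gap : (L : List X) (m : ℕ) (g : X → ℕ) →
  ∑[ x ∈ L ] (m * m) + ∑[ x ∈ L ] (g x * g x) ≡ 2 * (m * ∑ L g) + ∑[ x ∈ L ] (∣ m - g x ∣ * ∣ m - g x ∣)
∑-square-gap L m g = begin
  ∑[ x ∈ L ] (m * m) + ∑[ x ∈ L ] (g x * g x)      ≡⟨ sym (∑-+ L _ _) ⟩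
  ∑[ x ∈ L ] (m * m + g x * g x)                   ≡⟨ ∑-cong L (λ x → square-gap m (g x)) ⟩
  ∑[ x ∈ L ] (2 * (m * g x) + gap x)               ≡⟨ ∑-+ L _ gap ⟩
  ∑[ x ∈ L ] (2 * (m * g x)) + ∑ L gap
    ≡⟨ cong (_+ ∑ L gap) (trans (∑-*ˡ L 2 _) (cong (2 *_) (∑-*ˡ L m g))) ⟩
  2 * (m * ∑ L g) + ∑ L gap                        ∎
  where
  open ≡-Reasoning
  gap : _ → ℕ
  gap x = ∣ m - g x ∣ * ∣ m - g x ∣

^-+2 : ∀ q D → q ^ (D + 2) ≡ q * q * q ^ D
^-+2 q D = trans (^-distribˡ-+-* q D 2) (solve 2 (λ q r → r :* (q :* (q :* con 1)) := q :* q :* r) refl q (q ^ D))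
  where open +-*-Solver

1≤base : ∀ {k} a b → k < a ^ 2 * b → 1 ≤ a
1≤base (suc a) b _ = s≤s z≤n

module FieldGeometry (F : FiniteField) where
  open FiniteField F using (Carrier; 0#; isCommutativeRing; inverse; enum)
    renaming (_+_ to _+ᶠ_; _*_ to _*ᶠ_; -_ to -ᶠ_)
  open Geometry F

  commutativeRing : CommutativeRing 0ℓ 0ℓ
  commutativeRing = record { isCommutativeRing = isCommutativeRing }

  private
    module R = CommutativeRing commutativeRing
  open import Algebra.Properties.Ring R.ring using (+-cancelʳ; -‿+-comm; x[y-z]≈xy-xz)
  open import Algebra.Properties.CommutativeSemigroup R.+-commutativeSemigroup using (interchange)

  -- Equality of field elements is decidable, by transport along the enumeration.
  _≟_ : DecidableEquality Carrier
  x ≟ y = map′ (λ e → trans (sym (to-from x)) (trans (cong to e) (to-from y))) (cong from) (from x ≟Fin from y)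
    where
    open Inverse enum
    to-from = strictlyInverseˡ

  ·-comm : ∀ {d} (u v : Vec Carrier d) → u · v ≡ v · u
  ·-comm []      []      = refl
  ·-comm (a ∷ u) (b ∷ v) = cong₂ _+ᶠ_ (R.*-comm a b) (·-comm u v)

  ·-⊖ʳ : ∀ {d} (n u v : Vec Carrier d) → n · (u ⊖ v) ≡ n · u +ᶠ -ᶠ (n · v)
  ·-⊖ʳ []      []      []      = sym (R.-‿inverseʳ 0#)
  ·-⊖ʳ (a ∷ n) (b ∷ u) (c ∷ v) = begin
    a *ᶠ (b +ᶠ -ᶠ c) +ᶠ n · (u ⊖ v)               ≡⟨ cong₂ _+ᶠ_ (x[y-z]≈xy-xz a b c) (·-⊖ʳ n u v) ⟩
    (a *ᶠ b +ᶠ -ᶠ (a *ᶠ c)) +ᶠ (n · u +ᶠ -ᶠ (n · v)) ≡⟨ interchange (a *ᶠ b) _ (n · u) _ ⟩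
    (a *ᶠ b +ᶠ n · u) +ᶠ (-ᶠ (a *ᶠ c) +ᶠ -ᶠ (n · v)) ≡⟨ cong ((a *ᶠ b +ᶠ n · u) +ᶠ_) (-‿+-comm (a *ᶠ c) (n · v)) ⟩
    (a *ᶠ b +ᶠ n · u) +ᶠ -ᶠ (a *ᶠ c +ᶠ n · v)       ∎
    where open ≡-Reasoning

  ·-⊖ʳ-≡0 : ∀ {d} (n u v : Vec Carrier d) → n · u ≡ n · v → n · (u ⊖ v) ≡ 0#
  ·-⊖ʳ-≡0 n u v e = trans (·-⊖ʳ n u v) (trans (cong (_+ᶠ -ᶠ (n · v)) e) (R.-‿inverseʳ (n · v)))

  ⊖-cancelʳ : ∀ {d} (u v w : Vec Carrier d) → u ⊖ w ≡ v ⊖ w → u ≡ v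
  ⊖-cancelʳ []      []      []      _ = refl
  ⊖-cancelʳ (a ∷ u) (b ∷ v) (c ∷ w) e =
    cong₂ _∷_ (+-cancelʳ (-ᶠ c) a b (Vec.∷-injectiveˡ e)) (⊖-cancelʳ u v w (Vec.∷-injectiveʳ e))

  ⊖-self : ∀ {d} (v : Vec Carrier d) → v ⊖ v ≡ replicate d 0#
  ⊖-self []      = refl
  ⊖-self (a ∷ v) = cong₂ _∷_ (R.-‿inverseʳ a) (⊖-self v)

  ⊖≡0⇒≡ : ∀ {d} (u v : Vec Carrier d) → u ⊖ v ≡ replicate d 0# → u ≡ v
  ⊖≡0⇒≡ u v e = ⊖-cancelʳ u v v (trans e (sym (⊖-self v)))

  *-cancelʳ-≢0 : ∀ {w} → w ≢ 0# → ∀ c c′ → c *ᶠ w ≡ c′ *ᶠ w → c ≡ c′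
  *-cancelʳ-≢0 {w} w≢0 c c′ e with inverse w w≢0
  ... | w⁻¹ , ww⁻¹≡1 = trans (divide c) (trans (cong (_*ᶠ w⁻¹) e) (sym (divide c′)))
    where
    divide : ∀ x → x ≡ (x *ᶠ w) *ᶠ w⁻¹
    divide x = trans (sym (R.*-identityʳ x)) (trans (cong (x *ᶠ_) (sym ww⁻¹≡1)) (sym (R.*-assoc x w w⁻¹)))

  ·-headˡ-injective : ∀ {d} {w c c′} {ws ns : Vec Carrier d} → w ≢ 0# →
                      (c ∷ ns) · (w ∷ ws) ≡ (c′ ∷ ns) · (w ∷ ws) → c ≡ c′
  ·-headˡ-injective {ws = ws} {ns} w≢0 e = *-cancelʳ-≢0 w≢0 _ _ (+-cancelʳ (ns · ws) _ _ e)

  ·-head-zero : ∀ {d} c (ns ws : Vec Carrier d) → (c ∷ ns) · (0# ∷ ws) ≡ ns · ws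
  ·-head-zero c ns ws = trans (cong (_+ᶠ ns · ws) (R.zeroʳ c)) (R.+-identityˡ (ns · ws))

  _≟ᵥ_ : ∀ {d} → DecidableEquality (Vec Carrier d)
  _≟ᵥ_ = Vec.≡-dec _≟_

  rightAngle? : ∀ {d} (x y z : Vec Carrier d) → Dec (RightAngle x y z)
  rightAngle? x y z = ¬? (x ≟ᵥ y) ×-dec ¬? (y ≟ᵥ z) ×-dec ¬? (x ≟ᵥ z) ×-dec (((x ⊖ y) · (z ⊖ y)) ≟ 0#)

module InFiniteField (F : FiniteField) where
  open FiniteField F using (Carrier; 0#; size; enum)
  open Geometry F
  open FieldGeometry F
  open Enumeration

  private
    q = size

  𝔽 : Enumeration Carrier
  𝔽 = fromFin enum

  𝔽^ : (D : ℕ) → Enumeration (Vec Carrier D)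
  𝔽^ D = vectorEnum 𝔽 D

  scalars : List Carrier
  scalars = elements 𝔽

  points : (D : ℕ) → List (Vec Carrier D)
  points D = elements (𝔽^ D)

  ∣scalars∣ : length scalars ≡ q
  ∣scalars∣ = length-fromFin enum

  ∣points∣ : ∀ D → length (points D) ≡ q ^ D
  ∣points∣ D = trans (length-vectors scalars D) (cong (_^ D) ∣scalars∣)

  ∑-points-1 : ∀ D → ∑[ n ∈ points D ] 1 ≡ q ^ D
  ∑-points-1 D = trans (∑-const (points D) 1) (trans (*-identityʳ _) (∣points∣ D))

  -- Induct on d, splitting off the first
  -- coordinate w₀ of w: if w₀ ≠ 0 then the first coordinate of n is
  -- determined by the others, and if w₀ = 0 the rest of w is nonzero.
  hyperplane-count : ∀ d (w : Vec Carrier (suc d)) → w ≢ replicate _ 0# → (k : Carrier) →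
                     ∑[ n ∈ points (suc d) ] 𝟙 ((n · w) ≟ k) ≤ q ^ d
  hyperplane-count d (w₀ ∷ ws) w≢0 k with w₀ ≟ 0#
  ... | no w₀≢0 = begin
    ∑[ n ∈ points (suc d) ] 𝟙 ((n · (w₀ ∷ ws)) ≟ k)
      ≡⟨ ∑-cartesianProductWith _∷_ scalars (points d) _ ⟩
    ∑[ c ∈ scalars ] ∑[ ns ∈ points d ] 𝟙 (((c ∷ ns) · (w₀ ∷ ws)) ≟ k)   ≡⟨ ∑-swap scalars (points d) _ ⟩
    ∑[ ns ∈ points d ] ∑[ c ∈ scalars ] 𝟙 (((c ∷ ns) · (w₀ ∷ ws)) ≟ k)   ≤⟨ ∑-mono (points d) (λ ns _ → one-c ns) ⟩
    ∑[ ns ∈ points d ] 1                                                ≡⟨ ∑-points-1 d ⟩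
    q ^ d                                                               ∎
    where
    open ≤-Reasoning
    one-c : ∀ ns → ∑[ c ∈ scalars ] 𝟙 (((c ∷ ns) · (w₀ ∷ ws)) ≟ k) ≤ 1
    one-c ns = count≤1 scalars (unique 𝔽) _
                 (λ c c′ _ _ e e′ → ·-headˡ-injective {ws = ws} {ns} w₀≢0 (trans e (sym e′)))
  hyperplane-count zero    (w₀ ∷ []) w≢0 k | yes refl = ⊥-elim (w≢0 refl)
  hyperplane-count (suc d) (w₀ ∷ ws) w≢0 k | yes refl = begin
    ∑[ n ∈ points (suc (suc d)) ] 𝟙 ((n · (0# ∷ ws)) ≟ k)
      ≡⟨ ∑-cartesianProductWith _∷_ scalars (points (suc d)) _ ⟩
    ∑[ c ∈ scalars ] ∑[ ns ∈ points (suc d) ] 𝟙 (((c ∷ ns) · (0# ∷ ws)) ≟ k)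
      ≤⟨ ∑-mono scalars (λ c _ → ∑-mono (points (suc d)) (λ ns _ →
           𝟙-mono (_ ≟ k) (_ ≟ k) (trans (sym (·-head-zero c ns ws))))) ⟩
    ∑[ c ∈ scalars ] ∑[ ns ∈ points (suc d) ] 𝟙 ((ns · ws) ≟ k)
      ≤⟨ ∑-mono scalars (λ c _ → hyperplane-count d ws (λ ws≡0 → w≢0 (cong (0# ∷_) ws≡0)) k) ⟩
    ∑[ c ∈ scalars ] (q ^ d)                                               ≡⟨ ∑-const scalars (q ^ d) ⟩
    length scalars * q ^ d                                                 ≡⟨ cong (_* q ^ d) ∣scalars∣ ⟩
    q ^ suc d                                                              ∎
    where open ≤-Reasoning

  module Incidences (d : ℕ) (A : List (Vec Carrier (suc d))) (uA : Unique A) where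

    -- The pair (n , c) stands for {x : n · x = c}; n = 0 is allowed.
    Hyperplane : Set
    Hyperplane = Vec Carrier (suc d) × Carrier

    ℋ : Enumeration Hyperplane
    ℋ = productEnum (𝔽^ (suc d)) 𝔽

    hyperplanes : List Hyperplane
    hyperplanes = elements ℋ

    ∑ℋ : (g : Hyperplane → ℕ) → ∑ hyperplanes g ≡ ∑[ n ∈ points (suc d) ] ∑[ c ∈ scalars ] g (n , c)
    ∑ℋ = ∑-cartesianProductWith _,_ (points (suc d)) scalars

    ∣ℋ∣ : length hyperplanes ≡ q ^ suc d * q
    ∣ℋ∣ = trans (length-cartesianProductWith _,_ (points (suc d)) scalars)
                (cong₂ _*_ (∣points∣ (suc d)) ∣scalars∣)

    a : ℕ
    a = length A

    on : Hyperplane → ℕ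
    on (n , c) = ∑[ x ∈ A ] 𝟙 ((n · x) ≟ c)

    -- First moment: for each n, every point x lies on exactly one of the
    -- hyperplanes (n , c), namely c = n · x.
    ∑-on : ∑ hyperplanes on ≡ q ^ suc d * a
    ∑-on = begin
      ∑ hyperplanes on                                                 ≡⟨ ∑ℋ on ⟩
      ∑[ n ∈ points (suc d) ] ∑[ c ∈ scalars ] on (n , c)
        ≡⟨ ∑-cong (points (suc d)) (λ n → ∑-swap scalars A _) ⟩
      ∑[ n ∈ points (suc d) ] ∑[ x ∈ A ] ∑[ c ∈ scalars ] 𝟙 ((n · x) ≟ c)
        ≡⟨ ∑-cong (points (suc d)) (λ n → ∑-cong A (λ x → one-level (n · x))) ⟩
      ∑[ n ∈ points (suc d) ] ∑[ x ∈ A ] 1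
        ≡⟨ ∑-cong (points (suc d)) (λ n → trans (∑-const A 1) (*-identityʳ a)) ⟩
      ∑[ n ∈ points (suc d) ] a                                        ≡⟨ ∑-const (points (suc d)) a ⟩
      length (points (suc d)) * a                                      ≡⟨ cong (_* a) (∣points∣ (suc d)) ⟩
      q ^ suc d * a                                                    ∎
      where
      open ≡-Reasoning
      one-level : ∀ u → ∑[ c ∈ scalars ] 𝟙 (u ≟ c) ≡ 1
      one-level u = trans (∑-cong scalars (λ c → sym (*-identityʳ _)))
                          (∑-pick _≟_ scalars (unique 𝔽) (complete 𝔽 u) (λ _ → 1))

    -- The number of normals n with n · x = n · x′: all q^(d+1) if x = x′,
    -- and at most q^d otherwise, since then n ⊥ x′ − x ≠ 0.
    coincidences : ∀ x x′ → ∑[ n ∈ points (suc d) ] 𝟙 ((n · x′) ≟ (n · x)) ≤ q ^ d + 𝟙 (x ≟ᵥ x′) * q ^ suc d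
    coincidences x x′ with x ≟ᵥ x′
    ... | yes _ = begin
      ∑[ n ∈ points (suc d) ] 𝟙 ((n · x′) ≟ (n · x))    ≤⟨ ∑-mono (points (suc d)) (λ n _ → 𝟙≤1 _) ⟩
      ∑[ n ∈ points (suc d) ] 1                         ≡⟨ ∑-points-1 (suc d) ⟩
      q ^ suc d                                         ≡⟨ sym (+-identityʳ (q ^ suc d)) ⟩
      1 * q ^ suc d                                     ≤⟨ m≤n+m _ (q ^ d) ⟩
      q ^ d + 1 * q ^ suc d                             ∎
      where open ≤-Reasoning
    ... | no x≢x′ = begin
      ∑[ n ∈ points (suc d) ] 𝟙 ((n · x′) ≟ (n · x))
        ≤⟨ ∑-mono (points (suc d)) (λ n _ → 𝟙-mono (_ ≟ _) (_ ≟ _) (·-⊖ʳ-≡0 n x′ x)) ⟩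
      ∑[ n ∈ points (suc d) ] 𝟙 ((n · (x′ ⊖ x)) ≟ 0#)
        ≤⟨ hyperplane-count d (x′ ⊖ x) (λ e → x≢x′ (sym (⊖≡0⇒≡ x′ x e))) 0# ⟩
      q ^ d                                             ≤⟨ m≤m+n _ _ ⟩
      q ^ d + 0 * q ^ suc d                             ∎
      where open ≤-Reasoning

    -- Second moment: Σ on² counts triples (x, x′, p) with x, x′ ∈ A both on p.
    ∑-on² : ∑[ p ∈ hyperplanes ] (on p * on p) ≤ a * (a * q ^ d + q ^ suc d)
    ∑-on² = begin
      ∑[ p ∈ hyperplanes ] (on p * on p)
        ≡⟨ ∑-cong hyperplanes (λ p → ∑-product A A (I p) (I p)) ⟩
      ∑[ p ∈ hyperplanes ] ∑[ x ∈ A ] ∑[ x′ ∈ A ] (I p x * I p x′)     ≡⟨ ∑-swap hyperplanes A _ ⟩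
      ∑[ x ∈ A ] ∑[ p ∈ hyperplanes ] ∑[ x′ ∈ A ] (I p x * I p x′)     ≡⟨ ∑-cong A (λ x → ∑-swap hyperplanes A _) ⟩
      ∑[ x ∈ A ] ∑[ x′ ∈ A ] ∑[ p ∈ hyperplanes ] (I p x * I p x′)
        ≡⟨ ∑-cong A (λ x → ∑-cong A (λ x′ → common-level x x′)) ⟩
      ∑[ x ∈ A ] ∑[ x′ ∈ A ] ∑[ n ∈ points (suc d) ] 𝟙 ((n · x′) ≟ (n · x))
        ≤⟨ ∑-mono A (λ x _ → ∑-mono A (λ x′ _ → coincidences x x′)) ⟩
      ∑[ x ∈ A ] ∑[ x′ ∈ A ] (q ^ d + 𝟙 (x ≟ᵥ x′) * q ^ suc d)         ≤⟨ ∑-mono A (λ x _ → row x) ⟩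
      ∑[ x ∈ A ] (a * q ^ d + q ^ suc d)                               ≡⟨ ∑-const A _ ⟩
      a * (a * q ^ d + q ^ suc d)                                      ∎
      where
      open ≤-Reasoning
      I : Hyperplane → Vec Carrier (suc d) → ℕ
      I (n , c) x = 𝟙 ((n · x) ≟ c)
      -- for fixed n, x and x′ share the hyperplane (n , n · x) or none
      common-level : ∀ x x′ → ∑[ p ∈ hyperplanes ] (I p x * I p x′) ≡ ∑[ n ∈ points (suc d) ] 𝟙 ((n · x′) ≟ (n · x))
      common-level x x′ = trans (∑ℋ _) (∑-cong (points (suc d)) (λ n →
        ∑-pick _≟_ scalars (unique 𝔽) (complete 𝔽 (n · x)) (λ c → 𝟙 ((n · x′) ≟ c))))
      row : ∀ x → ∑[ x′ ∈ A ] (q ^ d + 𝟙 (x ≟ᵥ x′) * q ^ suc d) ≤ a * q ^ d + q ^ suc d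
      row x = begin
        ∑[ x′ ∈ A ] (q ^ d + 𝟙 (x ≟ᵥ x′) * q ^ suc d)                 ≡⟨ ∑-+ A _ _ ⟩
        ∑[ x′ ∈ A ] (q ^ d) + ∑[ x′ ∈ A ] (𝟙 (x ≟ᵥ x′) * q ^ suc d)
          ≡⟨ cong₂ _+_ (∑-const A (q ^ d)) (∑-*ʳ A (q ^ suc d) _) ⟩
        a * q ^ d + ∑[ x′ ∈ A ] 𝟙 (x ≟ᵥ x′) * q ^ suc d
          ≤⟨ +-monoʳ-≤ (a * q ^ d) (*-monoˡ-≤ (q ^ suc d) at-most-one) ⟩
        a * q ^ d + 1 * q ^ suc d                                     ≡⟨ cong (a * q ^ d +_) (*-identityˡ (q ^ suc d)) ⟩
        a * q ^ d + q ^ suc d                                         ∎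
        where
        at-most-one : ∑[ x′ ∈ A ] 𝟙 (x ≟ᵥ x′) ≤ 1
        at-most-one = count≤1 A uA _ (λ y y′ _ _ x≡y x≡y′ → trans (sym x≡y) x≡y′)

    -- The squared deviation of q · on p from a; its average over the
    -- q^(d+2) hyperplanes p is the variance of the counts on.
    deviation : Hyperplane → ℕ
    deviation p = ∣ a - q * on p ∣ * ∣ a - q * on p ∣

    -- Variance bound: expanding (a − q·on)² and inserting both moments,
    -- Σ deviation ≤ a q^(d+3).
    deviation-bound : ∑ hyperplanes deviation ≤ a * (q * q * q ^ suc d)
    deviation-bound = cancel-cross mean² (∑[ p ∈ H ] (q * on p * (q * on p))) (∑ H deviation) _ expand squares
      where
      open +-*-Solver
      H = hyperplanes
      mean² = a * a * (q * q ^ suc d)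
      constant-term : ∑[ p ∈ H ] (a * a) ≡ mean²
      constant-term = begin
        ∑[ p ∈ H ] (a * a)           ≡⟨ ∑-const H (a * a) ⟩
        length H * (a * a)           ≡⟨ cong (_* (a * a)) ∣ℋ∣ ⟩
        q ^ suc d * q * (a * a)
          ≡⟨ solve 3 (λ a q r → r :* q :* (a :* a) := a :* a :* (q :* r)) refl a q (q ^ suc d) ⟩
        mean²                        ∎
        where open ≡-Reasoning
      cross-term : 2 * (a * ∑[ p ∈ H ] (q * on p)) ≡ mean² + mean²
      cross-term = begin
        2 * (a * ∑[ p ∈ H ] (q * on p))  ≡⟨ cong (λ s → 2 * (a * s)) (trans (∑-*ˡ H q on) (cong (q *_) ∑-on)) ⟩
        2 * (a * (q * (q ^ suc d * a)))
          ≡⟨ solve 3 (λ a q r → con 2 :* (a :* (q :* (r :* a))) := a :* a :* (q :* r) :+ a :* a :* (q :* r)) refl a q (q ^ suc d) ⟩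
        mean² + mean²                    ∎
        where open ≡-Reasoning
      expand : mean² + ∑[ p ∈ H ] (q * on p * (q * on p)) ≡ (mean² + mean²) + ∑ H deviation
      expand = begin
        mean² + ∑[ p ∈ H ] (q * on p * (q * on p))
          ≡⟨ cong (_+ ∑[ p ∈ H ] (q * on p * (q * on p))) (sym constant-term) ⟩
        ∑[ p ∈ H ] (a * a) + ∑[ p ∈ H ] (q * on p * (q * on p))     ≡⟨ ∑-square-gap H a (λ p → q * on p) ⟩
        2 * (a * ∑[ p ∈ H ] (q * on p)) + ∑ H deviation             ≡⟨ cong (_+ ∑ H deviation) cross-term ⟩
        (mean² + mean²) + ∑ H deviation                             ∎
        where open ≡-Reasoning
      squares : ∑[ p ∈ H ] (q * on p * (q * on p)) ≤ mean² + a * (q * q * q ^ suc d)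
      squares = begin
        ∑[ p ∈ H ] (q * on p * (q * on p))
          ≡⟨ ∑-cong H (λ p → solve 2 (λ q f → q :* f :* (q :* f) := q :* q :* (f :* f)) refl q (on p)) ⟩
        ∑[ p ∈ H ] (q * q * (on p * on p))     ≡⟨ ∑-*ˡ H (q * q) _ ⟩
        q * q * ∑[ p ∈ H ] (on p * on p)       ≤⟨ *-monoʳ-≤ (q * q) ∑-on² ⟩
        q * q * (a * (a * q ^ d + q ^ suc d))  ≡⟨ solve 3 (λ a q r → q :* q :* (a :* (a :* r :+ q :* r))
                                                     := a :* a :* (q :* (q :* r)) :+ a :* (q :* q :* (q :* r))) refl a q (q ^ d) ⟩
        mean² + a * (q * q * q ^ suc d)        ∎
        where open ≤-Reasoning

  module RightAngleFree (d : ℕ) (A B : List (Vec Carrier (suc d))) (uA : Unique A) (uB : Unique B)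
    (disjoint : ∀ v → v ∈ A → v ∉ B)
    (no-right-angle : ∀ x y z → x ∈ A → y ∈ A → z ∈ B → ¬ RightAngle x y z) where

    open Incidences d A uA

    b : ℕ
    b = length B

    -- The hyperplane through y ∈ A with normal z − y (z ∈ B) meets A only
    -- in y: any other point x on it would give a right angle (x, y, z).
    isolated : ∀ x y z → x ∈ A → y ∈ A → z ∈ B → (z ⊖ y) · x ≡ (z ⊖ y) · y → x ≡ y
    isolated x y z x∈ y∈ z∈ e with x ≟ᵥ y
    ... | yes x≡y = x≡y
    ... | no x≢y  = ⊥-elim (no-right-angle x y z x∈ y∈ z∈ (x≢y , y≢z , x≢z , orthogonal))
      where
      y≢z : y ≢ z
      y≢z refl = disjoint y y∈ z∈
      x≢z : x ≢ z
      x≢z refl = disjoint x x∈ z∈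
      orthogonal : (x ⊖ y) · (z ⊖ y) ≡ 0#
      orthogonal = trans (·-comm (x ⊖ y) (z ⊖ y)) (·-⊖ʳ-≡0 (z ⊖ y) x y e)

    normal : Vec Carrier (suc d) × Vec Carrier (suc d) → Hyperplane
    normal (y , z) = z ⊖ y , (z ⊖ y) · y

    -- Distinct pairs have distinct hyperplanes: the hyperplane determines y
    -- (its only point in A), and then z from the normal z − y.
    normal-injective : ∀ p p′ → p ∈ cartesianProduct A B → p′ ∈ cartesianProduct A B →
                       normal p ≡ normal p′ → p ≡ p′
    normal-injective (y , z) (y′ , z′) p∈ p′∈ e = cong₂ _,_ (sym y′≡y) z≡z′
      where
      y∈ = proj₁ (∈-cartesianProduct⁻ A B p∈)
      z∈ = proj₂ (∈-cartesianProduct⁻ A B p∈)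
      y′∈ = proj₁ (∈-cartesianProduct⁻ A B p′∈)
      same-normal : z ⊖ y ≡ z′ ⊖ y′
      same-normal = cong proj₁ e
      y′≡y : y′ ≡ y
      y′≡y = isolated y′ y z y′∈ y∈ z∈ (trans (cong (_· y′) same-normal) (sym (cong proj₂ e)))
      z≡z′ : z ≡ z′
      z≡z′ = ⊖-cancelʳ z z′ y (trans same-normal (cong (z′ ⊖_) y′≡y))

    -- The hyperplane of (y, z) carries a single point of A, far below the
    -- average a/q, so it contributes at least (a − q)² to the deviation.
    normal-deviation : ∀ p → p ∈ cartesianProduct A B → (a ∸ q) * (a ∸ q) ≤ deviation (normal p)
    normal-deviation (y , z) p∈ = *-mono-≤ a∸q≤ a∸q≤
      where
      y∈ = proj₁ (∈-cartesianProduct⁻ A B p∈)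
      z∈ = proj₂ (∈-cartesianProduct⁻ A B p∈)
      on≤1 : on (normal (y , z)) ≤ 1
      on≤1 = count≤1 A uA _ (λ x x′ x∈ x′∈ e e′ → trans (isolated x y z x∈ y∈ z∈ e) (sym (isolated x′ y z x′∈ y∈ z∈ e′)))
      a∸q≤ : a ∸ q ≤ ∣ a - q * on (normal (y , z)) ∣
      a∸q≤ = ≤-trans (∸-monoʳ-≤ a (≤-trans (*-monoʳ-≤ q on≤1) (≤-reflexive (*-identityʳ q)))) (m∸n≤∣m-n∣ a _)

    -- Lower bound: the ab pairs give distinct hyperplanes of large deviation.
    deviation-lower : a * b * ((a ∸ q) * (a ∸ q)) ≤ ∑ hyperplanes deviation
    deviation-lower = begin
      a * b * K                          ≡⟨ cong (_* K) (sym (length-cartesianProductWith _,_ A B)) ⟩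
      length AB * K                      ≡⟨ sym (∑-const AB K) ⟩
      ∑[ p ∈ AB ] K                      ≤⟨ ∑-mono AB normal-deviation ⟩
      ∑[ p ∈ AB ] deviation (normal p)
        ≤⟨ ∑-injective (Product.≡-dec _≟ᵥ_ _≟_) ℋ AB (cartesianProduct⁺ uA uB) normal normal-injective deviation ⟩
      ∑ hyperplanes deviation            ∎
      where
      open ≤-Reasoning
      K = (a ∸ q) * (a ∸ q)
      AB = cartesianProduct A B

    b≤q^D : b ≤ q ^ suc d
    b≤q^D = begin
      b                           ≡⟨ sym (trans (∑-const B 1) (*-identityʳ b)) ⟩
      ∑[ z ∈ B ] 1                ≤⟨ ∑-injective _≟ᵥ_ (𝔽^ (suc d)) B uB (λ z → z) (λ _ _ _ _ e → e) (λ _ → 1) ⟩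
      ∑[ n ∈ points (suc d) ] 1   ≡⟨ ∑-points-1 (suc d) ⟩
      q ^ suc d                   ∎
      where open ≤-Reasoning

    -- Comparing the two bounds on the deviation gives b(a − q)² ≤ q^(d+3);
    -- together with b ≤ q^(d+1) this yields a²b ≤ 4 q^(d+3).
    size-bound : 1 ≤ a → a * a * b ≤ 4 * (q * q * q ^ suc d)
    size-bound 1≤a = four-bound a b q (q ^ suc d) b[a∸q]²≤ b≤q^D
      where
      b[a∸q]²≤ : b * ((a ∸ q) * (a ∸ q)) ≤ q * q * q ^ suc d
      b[a∸q]²≤ = *-cancelˡ-≤ a {{>-nonZero 1≤a}}
        (≤-trans (≤-reflexive (sym (*-assoc a b _))) (≤-trans deviation-lower deviation-bound))

  right-angle-exists : ∀ d (A B : List (Vec Carrier (suc d))) → Unique A → Unique B →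
    (∀ v → v ∈ A → v ∉ B) → 4 * q ^ (suc d + 2) < length A ^ 2 * length B →
    ∃[ x ] ∃[ y ] ∃[ z ] (x ∈ A × y ∈ A × z ∈ B × RightAngle x y z)
  right-angle-exists d A B uA uB disjoint large with search₃ rightAngle? A A B
  ... | yes found = found
  ... | no none   = ⊥-elim (<⇒≱ large (begin
    length A ^ 2 * length B         ≡⟨ cong (λ s → length A * s * length B) (*-identityʳ (length A)) ⟩
    length A * length A * length B  ≤⟨ size-bound (1≤base (length A) (length B) large) ⟩
    4 * (q * q * q ^ suc d)         ≡⟨ cong (4 *_) (sym (^-+2 q (suc d))) ⟩
    4 * q ^ (suc d + 2)             ∎))
    where
    open ≤-Reasoning
    open RightAngleFree d A B uA uB disjoint
      (λ x y z x∈ y∈ z∈ xyz → none (x , y , z , x∈ , y∈ , z∈ , xyz))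

-- The theorem with C = 4.
theorem1 : Σ[ C ∈ ℕ ] (0 < C × ((F : FiniteField) → (d : ℕ) → 1 ≤ d → (A B : List (Vec (FiniteField.Carrier F) d)) → (∃[ p ] ∃[ k ] (Prime p × p ≢ 2 × 1 ≤ k × FiniteField.size F ≡ p ^ k)) → Unique A → Unique B → (∀ v → v ∈ A → v ∉ B) → C * FiniteField.size F ^ (d + 2) < length A ^ 2 * length B → ∃[ x ] ∃[ y ] ∃[ z ] (x ∈ A × y ∈ A × z ∈ B × Geometry.RightAngle F x y z)))
theorem1 = 4 , s≤s z≤n , λ where
  F zero ()
  F (suc d) _ A B _ uA uB disjoint large → InFiniteField.right-angle-exists F d A B uA uB disjoint large
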